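{- Let $\mathcal{G}=(V,E,\mathcal{E})$ be an extended graph and let $u,v\in V$ be distinct vertices such that $N^2[v]\subseteq N^2[u]$. Then there is a maximum 2-packing set of $\mathcal{G}$ that does not contain $u$. In particular, with $\mathcal{G}'=\mathcal{G}[V\setminus\{u\}]$, we have $\beta(\mathcal{G})=\beta(\mathcal{G}')$.
   Context: Let $H=(V_H,E_H)$ be a finite simple undirected graph and let $\mathcal{E}_H$ be the set of unordered pairs $\{x,y\}$ of distinct vertices with $\{x,y\}\notin E_H$ that have a common neighbor in $H$ ("2-edges"). An extended graph $\mathcal{G}=(V,E,\mathcal{E})$ is obtained from such an $H$ by choosing $V\subseteq V_H$ and letting $E$ (resp. $\mathcal{E}$) be the pairs of $E_H$ (resp. $\mathcal{E}_H$) with both endpoints in $V$; in particular $V=V_H$ gives the graph $H$ together with all its 2-edges. For $U\subseteq V$, $\mathcal{G}[U]$ denotes the extended graph on $U$ keeping exactly the pairs of $E$ and of $\mathcal{E}$ with both endpoints in $U$. For $v\in V$: $N(v)=\{x:\{x,v\}\in E\}$, $N[v]=N(v)\cup\{v\}$, $\deg(v)=|N(v)|$, $N^2(v)=\{x:\{x,v\}\in\mathcal{E}\}$, $N^2[v]=N^2(v)\cup N[v]$, $\deg_2(v)=|N^2(v)|$. A 2-packing set of $\mathcal{G}$ is a set $S\subseteq V$ such that no two distinct vertices of $S$ form a pair in $E\cup\mathcal{E}$. A maximum 2-packing set (M2S) is one of maximum cardinality, and $\beta(\mathcal{G})$ denotes this maximum cardinality. -}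

module Defs where

open import Data.Nat using (ℕ; _≤_)
open import Data.Bool using (Bool; true; false)
open import Data.Fin using (Fin)
open import Data.Fin.Subset using (Subset; _∈_; _∉_; _⊆_; ∣_∣; _-_)
open import Data.Product using (Σ; ∃; _×_; _,_)
open import Data.Sum using (_⊎_)
open import Relation.Nullary using (¬_)
open import Relation.Binary.PropositionalEquality using (_≡_; _≢_)

record Graph (n : ℕ) : Set where
  field
    adj    : Fin n → Fin n → Bool
    adjSym : ∀ x y → adj x y ≡ adj y x
    adjIrr : ∀ x → adj x x ≡ false
open Graph public

AdjH : ∀ {n} → Graph n → Fin n → Fin n → Set
AdjH H x y = adj H x y ≡ true

TwoAdjH : ∀ {n} → Graph n → Fin n → Fin n → Set
TwoAdjH H x y = x ≢ y × ¬ AdjH H x y × ∃ λ z → AdjH H x z × AdjH H z y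

-- An extended graph: an underlying graph H together with a vertex set V ⊆ V_H.
record ExtGraph (n : ℕ) : Set where
  constructor ext
  field
    base : Graph n
    verts : Subset n
open ExtGraph public

Edge : ∀ {n} → ExtGraph n → Fin n → Fin n → Set
Edge G x y = x ∈ verts G × y ∈ verts G × AdjH (base G) x y

TwoEdge : ∀ {n} → ExtGraph n → Fin n → Fin n → Set
TwoEdge G x y = x ∈ verts G × y ∈ verts G × TwoAdjH (base G) x y

InN2Closed : ∀ {n} → ExtGraph n → Fin n → Fin n → Set
InN2Closed G v x = x ∈ verts G × (x ≡ v ⊎ Edge G x v ⊎ TwoEdge G x v)

induced : ∀ {n} → ExtGraph n → Subset n → ExtGraph n
induced G U = ext (base G) U

deleteVertex : ∀ {n} → ExtGraph n → Fin n → ExtGraph n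
deleteVertex G u = induced G (verts G - u)

Is2Packing : ∀ {n} → ExtGraph n → Subset n → Set
Is2Packing G S = S ⊆ verts G ×
  (∀ x y → x ∈ S → y ∈ S → x ≢ y → ¬ Edge G x y × ¬ TwoEdge G x y)

IsM2S : ∀ {n} → ExtGraph n → Subset n → Set
IsM2S G S = Is2Packing G S × (∀ T → Is2Packing G T → ∣ T ∣ ≤ ∣ S ∣)

-- If a 2-packing S contains u, then S contains no other vertex of N²[u] ⊇ N²[v];
-- hence replacing u by v keeps S a 2-packing of the same size, and v ∉ S because
-- v ∈ N²[u] ∖ {u}. So some maximum 2-packing avoids u, and it is also a maximum
-- 2-packing of G − u, which forces β(G) = β(G − u).
module Submission where

open import Defs
open import Data.Nat using (ℕ; zero; suc; _≤_; _≤?_; z≤n; s≤s)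
open import Data.Nat.Properties using (≤-trans; ≤-antisym; ≤-reflexive; m≤n⇒m≤1+n; ≮⇒≥)
open import Data.Bool using (true)
open import Data.Bool.Properties using () renaming (_≟_ to _≟ᵇ_)
open import Data.Fin using (Fin; zero; suc)
open import Data.Fin.Properties using (all?; any?) renaming (_≟_ to _≟ᶠ_)
open import Data.Fin.Subset
open import Data.Fin.Subset.Properties
open import Data.Vec using (_∷_; here; there)
open import Data.Product using (Σ; ∃; _×_; _,_; proj₁; proj₂)
open import Data.Sum using (_⊎_; inj₁; inj₂)
open import Data.Empty using (⊥-elim)
open import Relation.Nullary using (¬_; Dec; yes; no)
open import Relation.Nullary.Decidable using (_×-dec_; _→-dec_; ¬?)
open import Relation.Unary using (Decidable)
open import Relation.Binary.PropositionalEquality using (_≡_; _≢_; refl; sym; trans; cong; subst)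

private variable n : ℕ

x∈p─q⇒x∉q : ∀ (p q : Subset n) {x} → x ∈ p ─ q → x ∉ q
x∈p─q⇒x∉q (_ ∷ p) (outside ∷ q) here      ()
x∈p─q⇒x∉q (_ ∷ p) (_ ∷ q)       (there m) (there k) = x∈p─q⇒x∉q p q m k

x∈p-y⇒x≢y : ∀ (p : Subset n) {x y} → x ∈ p - y → x ≢ y
x∈p-y⇒x≢y p {y = y} m = x∉⁅y⁆⇒x≢y (x∈p─q⇒x∉q p ⁅ y ⁆ m)

x∈p-y⇒x∈p : ∀ (p : Subset n) {x y} → x ∈ p - y → x ∈ p
x∈p-y⇒x∈p p {y = y} = p─q⊆p p ⁅ y ⁆

∣p∣≤1+∣p-x∣ : ∀ (p : Subset n) x → ∣ p ∣ ≤ suc ∣ p - x ∣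
∣p∣≤1+∣p-x∣ (outside ∷ p) zero    = m≤n⇒m≤1+n (≤-reflexive (cong ∣_∣ (sym (p─⊥≡p p))))
∣p∣≤1+∣p-x∣ (inside  ∷ p) zero    = s≤s (≤-reflexive (cong ∣_∣ (sym (p─⊥≡p p))))
∣p∣≤1+∣p-x∣ (outside ∷ p) (suc x) = ∣p∣≤1+∣p-x∣ p x
∣p∣≤1+∣p-x∣ (inside  ∷ p) (suc x) = s≤s (∣p∣≤1+∣p-x∣ p x)

∃-largest : {P : Subset n → Set} → Decidable P → P ⊥ →
            ∃ λ S → P S × (∀ T → P T → ∣ T ∣ ≤ ∣ S ∣)
∃-largest {n} {P} P? p⊥ = search n (λ T _ → ∣p∣≤n T)
  where
  search : ∀ k → (∀ T → P T → ∣ T ∣ ≤ k) → ∃ λ S → P S × (∀ T → P T → ∣ T ∣ ≤ ∣ S ∣)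
  search k bound with anySubset? (λ S → P? S ×-dec (k ≤? ∣ S ∣))
  ... | yes (S , pS , k≤∣S∣) = S , pS , λ T pT → ≤-trans (bound T pT) k≤∣S∣
  search zero    _ | no ∄ = ⊥-elim (∄ (⊥ , p⊥ , z≤n))
  search (suc k) _ | no ∄ = search k λ T pT → ≮⇒≥ λ k<∣T∣ → ∄ (T , pT , k<∣T∣)

module _ (G : ExtGraph n) where

  Edge-sym : ∀ {x y} → Edge G x y → Edge G y x
  Edge-sym {x} {y} (x∈V , y∈V , xy) = y∈V , x∈V , trans (adjSym (base G) y x) xy

  TwoEdge-sym : ∀ {x y} → TwoEdge G x y → TwoEdge G y x
  TwoEdge-sym {x} {y} (x∈V , y∈V , x≢y , ¬xy , z , xz , zy) =
    y∈V , x∈V , (λ y≡x → x≢y (sym y≡x)) , (λ yx → ¬xy (trans (adjSym (base G) x y) yx)) ,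
    z , trans (adjSym (base G) y z) zy , trans (adjSym (base G) z x) xz

  Edge? : ∀ x y → Dec (Edge G x y)
  Edge? x y = (x ∈? verts G) ×-dec (y ∈? verts G) ×-dec (adj (base G) x y ≟ᵇ true)

  TwoEdge? : ∀ x y → Dec (TwoEdge G x y)
  TwoEdge? x y = (x ∈? verts G) ×-dec (y ∈? verts G) ×-dec
    (¬? (x ≟ᶠ y) ×-dec ¬? (adj (base G) x y ≟ᵇ true) ×-dec
     any? (λ z → (adj (base G) x z ≟ᵇ true) ×-dec (adj (base G) z y ≟ᵇ true)))

  Is2Packing? : Decidable (Is2Packing G)
  Is2Packing? S = (S ⊆? verts G) ×-dec all? (λ x → all? (λ y →
    (x ∈? S) →-dec (y ∈? S) →-dec ¬? (x ≟ᶠ y) →-dec (¬? (Edge? x y) ×-dec ¬? (TwoEdge? x y))))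

  Is2Packing-⊥ : Is2Packing G ⊥
  Is2Packing-⊥ = (λ x∈⊥ → ⊥-elim (∉⊥ x∈⊥)) , λ _ _ x∈⊥ _ _ → ⊥-elim (∉⊥ x∈⊥)

  ∃-M2S : ∃ (IsM2S G)
  ∃-M2S = ∃-largest Is2Packing? Is2Packing-⊥

  M2S-size-unique : ∀ {S T} → IsM2S G S → IsM2S G T → ∣ S ∣ ≡ ∣ T ∣
  M2S-size-unique (pS , maxS) (pT , maxT) = ≤-antisym (maxT _ pS) (maxS _ pT)

  Is2Packing-induced⁺ : ∀ {U S} → U ⊆ verts G → Is2Packing (induced G U) S → Is2Packing G S
  Is2Packing-induced⁺ U⊆V (S⊆U , far) =
    (λ x∈S → U⊆V (S⊆U x∈S)) , λ x y x∈S y∈S x≢y →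
      (λ (_ , _ , xy) → proj₁ (far x y x∈S y∈S x≢y) (S⊆U x∈S , S⊆U y∈S , xy)) ,
      (λ (_ , _ , xy) → proj₂ (far x y x∈S y∈S x≢y) (S⊆U x∈S , S⊆U y∈S , xy))

  Is2Packing-induced⁻ : ∀ {U S} → U ⊆ verts G → S ⊆ U → Is2Packing G S → Is2Packing (induced G U) S
  Is2Packing-induced⁻ U⊆V S⊆U (_ , far) =
    S⊆U , λ x y x∈S y∈S x≢y →
      (λ (x∈U , y∈U , xy) → proj₁ (far x y x∈S y∈S x≢y) (U⊆V x∈U , U⊆V y∈U , xy)) ,
      (λ (x∈U , y∈U , xy) → proj₂ (far x y x∈S y∈S x≢y) (U⊆V x∈U , U⊆V y∈U , xy))

  IsM2S-induced : ∀ {U S} → U ⊆ verts G → S ⊆ U → IsM2S G S → IsM2S (induced G U) S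
  IsM2S-induced U⊆V S⊆U (pS , maxS) =
    Is2Packing-induced⁻ U⊆V S⊆U pS , λ T pT → maxS T (Is2Packing-induced⁺ U⊆V pT)

  Is2Packing⇒∉N²[u] : ∀ {S u y} → Is2Packing G S → u ∈ S → y ∈ S → y ≢ u → ¬ InN2Closed G u y
  Is2Packing⇒∉N²[u] _ _ _ y≢u (_ , inj₁ y≡u)                     = y≢u y≡u
  Is2Packing⇒∉N²[u] (_ , far) u∈S y∈S y≢u (_ , inj₂ (inj₁ yu)) = proj₁ (far _ _ y∈S u∈S y≢u) yu
  Is2Packing⇒∉N²[u] (_ , far) u∈S y∈S y≢u (_ , inj₂ (inj₂ yu)) = proj₂ (far _ _ y∈S u∈S y≢u) yu

  module Swap {u v : Fin n} (v∈V : v ∈ verts G) (u≢v : u ≢ v)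
              (N²[v]⊆N²[u] : ∀ x → InN2Closed G v x → InN2Closed G u x)
              {S : Subset n} (pS : Is2Packing G S) (u∈S : u ∈ S) where

    swapped : Subset n
    swapped = (S - u) ∪ ⁅ v ⁆

    v≢u : v ≢ u
    v≢u v≡u = u≢v (sym v≡u)

    v∉S : v ∉ S
    v∉S v∈S = Is2Packing⇒∉N²[u] pS u∈S v∈S v≢u (N²[v]⊆N²[u] v (v∈V , inj₁ refl))

    far-from-v : ∀ {y} → y ∈ S → y ≢ u → ¬ Edge G y v × ¬ TwoEdge G y v
    far-from-v {y} y∈S y≢u =
      (λ yv → ∉N²[u] (N²[v]⊆N²[u] y (y∈V , inj₂ (inj₁ yv)))) ,
      (λ yv → ∉N²[u] (N²[v]⊆N²[u] y (y∈V , inj₂ (inj₂ yv))))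
      where
      y∈V = proj₁ pS y∈S
      ∉N²[u] = Is2Packing⇒∉N²[u] pS u∈S y∈S y≢u

    ∈swapped⁻ : ∀ {x} → x ∈ swapped → (x ∈ S × x ≢ u) ⊎ x ≡ v
    ∈swapped⁻ x∈ with x∈p∪q⁻ (S - u) ⁅ v ⁆ x∈
    ... | inj₁ x∈S-u = inj₁ (x∈p-y⇒x∈p S x∈S-u , x∈p-y⇒x≢y S x∈S-u)
    ... | inj₂ x∈⁅v⁆ = inj₂ (x∈⁅y⁆⇒x≡y v x∈⁅v⁆)

    u∉swapped : u ∉ swapped
    u∉swapped u∈ with ∈swapped⁻ u∈
    ... | inj₁ (_ , u≢u) = u≢u refl
    ... | inj₂ u≡v       = u≢v u≡v

    swapped-Is2Packing : Is2Packing G swapped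
    swapped-Is2Packing = ⊆V , far
      where
      ⊆V : swapped ⊆ verts G
      ⊆V x∈ with ∈swapped⁻ x∈
      ... | inj₁ (x∈S , _) = proj₁ pS x∈S
      ... | inj₂ refl      = v∈V
      far : ∀ x y → x ∈ swapped → y ∈ swapped → x ≢ y → ¬ Edge G x y × ¬ TwoEdge G x y
      far x y x∈ y∈ x≢y with ∈swapped⁻ x∈ | ∈swapped⁻ y∈
      ... | inj₁ (x∈S , _)   | inj₁ (y∈S , _)   = proj₂ pS x y x∈S y∈S x≢y
      ... | inj₁ (x∈S , x≢u) | inj₂ refl        = far-from-v x∈S x≢u
      ... | inj₂ refl        | inj₁ (y∈S , y≢u) =
        (λ vy → proj₁ (far-from-v y∈S y≢u) (Edge-sym vy)) ,
        (λ vy → proj₂ (far-from-v y∈S y≢u) (TwoEdge-sym vy))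
      ... | inj₂ refl        | inj₂ refl        = ⊥-elim (x≢y refl)

    ∣S∣≤∣swapped∣ : ∣ S ∣ ≤ ∣ swapped ∣
    ∣S∣≤∣swapped∣ = ≤-trans (∣p∣≤1+∣p-x∣ S u) (p⊂q⇒∣p∣<∣q∣
      (p⊆p∪q ⁅ v ⁆ , v , q⊆p∪q (S - u) ⁅ v ⁆ (x∈⁅x⁆ v) , λ v∈S-u → v∉S (x∈p-y⇒x∈p S v∈S-u)))

  ∃-M2S-avoiding : ∀ {u v} → v ∈ verts G → u ≢ v → (∀ x → InN2Closed G v x → InN2Closed G u x) →
            Σ (Subset n) (λ S → IsM2S G S × u ∉ S)
  ∃-M2S-avoiding {u} v∈V u≢v N²[v]⊆N²[u] with ∃-M2S
  ... | S , pS , maxS with u ∈? S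
  ...   | no  u∉S = S , (pS , maxS) , u∉S
  ...   | yes u∈S = swapped , (swapped-Is2Packing , λ T pT → ≤-trans (maxS T pT) ∣S∣≤∣swapped∣) ,
                    u∉swapped
    where open Swap v∈V u≢v N²[v]⊆N²[u] pS u∈S

mainTheorem1 : ∀ {n} (G : ExtGraph n) (u v : Fin n) → u ∈ verts G → v ∈ verts G → u ≢ v
    → (∀ x → InN2Closed G v x → InN2Closed G u x)
    → Σ (Subset n) (λ S → IsM2S G S × u ∉ S)
      × (∀ S S′ → IsM2S G S → IsM2S (deleteVertex G u) S′ → ∣ S ∣ ≡ ∣ S′ ∣)
mainTheorem1 G u v _ v∈V u≢v N²[v]⊆N²[u] = (S₀ , m2s₀ , u∉S₀) , sizes
  where
  avoiding = ∃-M2S-avoiding G v∈V u≢v N²[v]⊆N²[u]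
  S₀ = proj₁ avoiding
  m2s₀ = proj₁ (proj₂ avoiding)
  u∉S₀ = proj₂ (proj₂ avoiding)

  S₀⊆V-u : S₀ ⊆ verts G - u
  S₀⊆V-u {x} x∈S₀ = x∈p∧x≢y⇒x∈p-y (proj₁ (proj₁ m2s₀) x∈S₀) λ x≡u → u∉S₀ (subst (_∈ S₀) x≡u x∈S₀)

  sizes : ∀ S S′ → IsM2S G S → IsM2S (deleteVertex G u) S′ → ∣ S ∣ ≡ ∣ S′ ∣
  sizes S S′ m2s m2s′ = trans (M2S-size-unique G m2s m2s₀)
    (M2S-size-unique (deleteVertex G u) (IsM2S-induced G (p─q⊆p (verts G) ⁅ u ⁆) S₀⊆V-u m2s₀) m2s′)
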